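{- Let $n\ge 5$ be an integer and let $C_n$ be the cycle on $n$ vertices. Then ${\rm im}(\mu_1(C_n))=4$, and ${\rm im}(\mu_m(C_n))=5$ for every integer $m\ge 2$.
   Context: For graphs $G$ and $H$, $G$ has an $H$-immersion if there is a one-to-one map $\phi:V(H)\to V(G)$ such that for each edge $uv\in E(H)$ there is a path $P_{uv}$ in $G$ joining $\phi(u)$ and $\phi(v)$, with the paths $P_{uv}$ pairwise edge-disjoint. The immersion number ${\rm im}(G)$ is the largest $t$ such that $G$ has a $K_t$-immersion. For an integer $m\ge1$, the $m$-Mycielskian $\mu_m(G)$ is the graph with vertex set $(V(G)\times\{0,1,\dots,m-1\})\cup\{w\}$ and edges $(u,0)(v,0)$ and $(u,i)(v,i+1)$ for all $uv\in E(G)$ (with $(u,i)(v,i+1)$ for $0\le i\le m-2$, in both orientations of $uv$), together with edges $(u,m-1)w$ for all $u\in V(G)$. -}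

module Defs where

open import Data.Nat using (ℕ; zero; suc; _≤_)
open import Data.Fin using (Fin; toℕ; _<_)
open import Data.Maybe using (Maybe; just; nothing)
open import Data.Product using (Σ; _×_; _,_)
open import Data.Sum using (_⊎_)
open import Data.Empty using (⊥)
open import Data.List using (List; []; _∷_)
open import Data.List.Membership.Propositional using (_∈_)
open import Data.List.Relation.Unary.Unique.Propositional using (Unique)
open import Relation.Binary.PropositionalEquality using (_≡_)
open import Relation.Nullary using (¬_)
open import Function.Definitions using (Injective)

record Graph : Set₁ where
  field
    V   : Set
    Adj : V → V → Set
open Graph public

data Walk (G : Graph) : V G → V G → Set where
  []   : ∀ {a} → Walk G a a
  step : ∀ {a b c} → Adj G a b → Walk G b c → Walk G a c

vertices : ∀ {G a b} → Walk G a b → List (V G)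
vertices {a = a} []         = a ∷ []
vertices {a = a} (step _ w) = a ∷ vertices w

edges : ∀ {G a b} → Walk G a b → List (V G × V G)
edges [] = []
edges {a = a} (step {b = b} _ w) = (a , b) ∷ edges w

IsPath : ∀ {G a b} → Walk G a b → Set
IsPath w = Unique (vertices w)

SameEdge : ∀ {A : Set} → A × A → A × A → Set
SameEdge (x , y) (x' , y') = (x ≡ x' × y ≡ y') ⊎ (x ≡ y' × y ≡ x')

EdgeDisjoint : ∀ {G a b c d} → Walk G a b → Walk G c d → Set
EdgeDisjoint w₁ w₂ = ∀ e₁ e₂ → e₁ ∈ edges w₁ → e₂ ∈ edges w₂ → ¬ SameEdge e₁ e₂

record KImmersion (G : Graph) (t : ℕ) : Set where
  field
    φ      : Fin t → V G
    φ-inj  : Injective _≡_ _≡_ φ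
    path   : (i j : Fin t) → i < j → Walk G (φ i) (φ j)
    isPath : (i j : Fin t) (p : i < j) → IsPath (path i j p)
    disj   : (i j k l : Fin t) (p : i < j) (q : k < l) →
             ¬ (i ≡ k × j ≡ l) → EdgeDisjoint (path i j p) (path k l q)

ImmersionNumber : Graph → ℕ → Set
ImmersionNumber G t = KImmersion G t × (∀ s → KImmersion G s → s ≤ t)

CycleAdj : (n : ℕ) → Fin n → Fin n → Set
CycleAdj n i j = suc (toℕ i) ≡ toℕ j ⊎ (suc (toℕ i) ≡ n × toℕ j ≡ 0)

Cycle : ℕ → Graph
Cycle n = record
  { V   = Fin n
  ; Adj = λ i j → CycleAdj n i j ⊎ CycleAdj n j i }

-- the m-Mycielskian: vertices (u,i) with i < m, plus w (= nothing)
MycAdj : (G : Graph) (m : ℕ) → Maybe (V G × Fin m) → Maybe (V G × Fin m) → Set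
MycAdj G m (just (u , i)) (just (v , j)) =
  Adj G u v × ((toℕ i ≡ 0 × toℕ j ≡ 0) ⊎ (suc (toℕ i) ≡ toℕ j ⊎ suc (toℕ j) ≡ toℕ i))
MycAdj G m (just (u , i)) nothing = suc (toℕ i) ≡ m
MycAdj G m nothing (just (v , j)) = suc (toℕ j) ≡ m
MycAdj G m nothing nothing = ⊥

Mycielskian : ℕ → Graph → Graph
Mycielskian m G = record
  { V   = Maybe (V G × Fin m)
  ; Adj = MycAdj G m }

-- If K_t is immersed in G, the t − 1 paths at a branch vertex leave it along pairwise distinct
-- edges, so every branch vertex has degree at least t − 1. In μ_m(C_n) every vertex other than the
-- apex w has degree at most 4 (at most 3 when m = 1), and at most one branch vertex is w; hence
-- im(μ_m(C_n)) ≤ 5, resp. ≤ 4. The matching immersions are explicit and checked by evaluation: for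
-- n ≤ 11 on the two bottom layers of μ_m(C_n); for longer cycles inside a fixed path of C_n, using w
-- as a shortcut (through the top three layers when m ≥ 3); and for m = 1 a wheel centred at w.

module Submission where

open import Defs
open import Data.Nat as ℕ using (ℕ; zero; suc; _≤_; _<_; _+_; _*_; z≤n; s≤s)
open import Data.Nat.Properties using (≮⇒≥; <-irrefl; suc-injective; +-suc; +-comm; m≤m+n; m≤n⇒∃[o]m+o≡n)
open import Data.Fin as Fin using (Fin; toℕ; punchIn; inject≤; _↑ˡ_; _↑ʳ_; #_)
open import Data.Fin.Patterns using (0F; 1F; 2F; 3F; 4F)
open import Data.Fin.Properties
  using (pigeonhole; punchIn-injective; punchInᵢ≢i; <-cmp; <⇒≢; toℕ-injective; toℕ<n; combine-injective;
         toℕ-inject≤; toℕ-↑ʳ; ↑ʳ-injective; all?; _<?_)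
  renaming (suc-injective to Fin-suc-injective; _≟_ to _≟ᶠ_)
open import Data.Bool using (Bool; true; false; not; if_then_else_)
open import Data.Empty using (⊥)
open import Data.Maybe using (Maybe; just; nothing)
import Data.Maybe.Properties as Maybe
open import Data.Product using (∃-syntax; _×_; _,_; proj₁; proj₂)
import Data.Product as Product
import Data.Product.Properties as Product
open import Data.Sum using (_⊎_; inj₁; inj₂)
open import Data.List as List using (List; []; _∷_; _++_; [_])
open import Data.List.Membership.Propositional using (_∈_)
open import Data.List.Membership.Propositional.Properties using (∈-map⁻)
open import Data.List.Relation.Unary.Any using (here; there)
open import Data.List.Relation.Unary.All as All using (All)
open import Data.List.Relation.Unary.Linked using (Linked; [-]; _∷_; linked?)
open import Data.List.Relation.Unary.Unique.Propositional using (Unique)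
import Data.List.Relation.Unary.Unique.Propositional.Properties as Unique
open import Data.List.Relation.Unary.Unique.DecPropositional using (unique?)
open import Function using (_∘_)
open import Relation.Binary using (Decidable; DecidableEquality; tri<; tri≈; tri>)
open import Relation.Binary.PropositionalEquality using (_≡_; _≢_; refl; sym; trans; cong; cong₂; subst; subst₂)
open import Relation.Nullary using (¬_; Dec; no; ¬?; _×-dec_; _⊎-dec_; _→-dec_; contradiction)
open import Relation.Nullary.Decidable using (from-yes)

-- Degree bounds

Undirected : Graph → Set
Undirected G = ∀ {a b} → Adj G a b → Adj G b a

record DegreeAtMost (G : Graph) (x : V G) (d : ℕ) : Set where
  field
    code           : ∀ {y} → Adj G x y → Fin d
    code-injective : ∀ {y z} (p : Adj G x y) (q : Adj G x z) → code p ≡ code q → y ≡ z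

SameEdge-sym : ∀ {A : Set} {e e′ : A × A} → SameEdge e e′ → SameEdge e′ e
SameEdge-sym (inj₁ (refl , refl)) = inj₁ (refl , refl)
SameEdge-sym (inj₂ (refl , refl)) = inj₂ (refl , refl)

SameEdge-trans : ∀ {A : Set} {e e′ e″ : A × A} → SameEdge e e′ → SameEdge e′ e″ → SameEdge e e″
SameEdge-trans (inj₁ (refl , refl)) q                    = q
SameEdge-trans (inj₂ (refl , refl)) (inj₁ (refl , refl)) = inj₂ (refl , refl)
SameEdge-trans (inj₂ (refl , refl)) (inj₂ (refl , refl)) = inj₁ (refl , refl)

module _ {G : Graph} where

  firstEdge : ∀ {a b} (w : Walk G a b) → a ≢ b → ∃[ y ] Adj G a y × (a , y) ∈ edges w
  firstEdge []         a≢b = contradiction refl a≢b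
  firstEdge (step r w) _   = _ , r , here refl

  lastEdgeOfStep : ∀ {a b c} (r : Adj G a b) (w : Walk G b c) →
                   ∃[ y ] Adj G y c × (y , c) ∈ edges (step r w)
  lastEdgeOfStep r []          = _ , r , here refl
  lastEdgeOfStep r (step r′ w) with lastEdgeOfStep r′ w
  ... | y , r″ , y∈ = y , r″ , there y∈

  lastEdge : ∀ {a b} (w : Walk G a b) → a ≢ b → ∃[ y ] Adj G y b × (y , b) ∈ edges w
  lastEdge []         a≢b = contradiction refl a≢b
  lastEdge (step r w) _   = lastEdgeOfStep r w

  module _ {t} (I : KImmersion G t) where
    open KImmersion I

    record Spoke (k j : Fin t) : Set where
      field
        end       : V G
        adjacent  : Adj G (φ k) end
        from to   : Fin t
        ordered   : from Fin.< to
        joins     : (from ≡ k × to ≡ j) ⊎ (from ≡ j × to ≡ k)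
        edge      : V G × V G
        edge∈path : edge ∈ edges (path from to ordered)
        edge-ends : SameEdge edge (φ k , end)

    spoke : Undirected G → ∀ k j → j ≢ k → Spoke k j
    spoke undirected k j j≢k with <-cmp k j
    ... | tri≈ _ k≡j _ = contradiction (sym k≡j) j≢k
    ... | tri< k<j _ _ with firstEdge (path k j k<j) (λ φk≡φj → j≢k (sym (φ-inj φk≡φj)))
    ...   | y , r , e∈ = record
      { end = y ; adjacent = r ; from = k ; to = j ; ordered = k<j ; joins = inj₁ (refl , refl)
      ; edge = _ ; edge∈path = e∈ ; edge-ends = inj₁ (refl , refl) }
    spoke undirected k j j≢k | tri> _ _ j<k with lastEdge (path j k j<k) (λ φj≡φk → j≢k (φ-inj φj≡φk))
    ...   | y , r , e∈ = record
      { end = y ; adjacent = undirected r ; from = j ; to = k ; ordered = j<k ; joins = inj₂ (refl , refl)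
      ; edge = _ ; edge∈path = e∈ ; edge-ends = inj₂ (refl , refl) }

    spokes-on-distinct-paths : ∀ {k j₁ j₂ i₁ l₁ i₂ l₂ : Fin t} → j₁ ≢ j₂ → j₁ ≢ k → j₂ ≢ k →
      (i₁ ≡ k × l₁ ≡ j₁) ⊎ (i₁ ≡ j₁ × l₁ ≡ k) → (i₂ ≡ k × l₂ ≡ j₂) ⊎ (i₂ ≡ j₂ × l₂ ≡ k) →
      ¬ (i₁ ≡ i₂ × l₁ ≡ l₂)
    spokes-on-distinct-paths j₁≢j₂ _ _ (inj₁ (refl , refl)) (inj₁ (refl , refl)) (_ , refl) = j₁≢j₂ refl
    spokes-on-distinct-paths _ _ j₂≢k (inj₁ (refl , refl)) (inj₂ (refl , refl)) (refl , _) = j₂≢k refl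
    spokes-on-distinct-paths _ j₁≢k _ (inj₂ (refl , refl)) (inj₁ (refl , refl)) (refl , _) = j₁≢k refl
    spokes-on-distinct-paths j₁≢j₂ _ _ (inj₂ (refl , refl)) (inj₂ (refl , refl)) (refl , _) = j₁≢j₂ refl

    spokes-with-same-end : ∀ {k j₁ j₂} (s₁ : Spoke k j₁) (s₂ : Spoke k j₂) →
                           Spoke.end s₁ ≡ Spoke.end s₂ → SameEdge (Spoke.edge s₁) (Spoke.edge s₂)
    spokes-with-same-end {k} s₁ s₂ same-end =
      SameEdge-trans (Spoke.edge-ends s₁)
        (SameEdge-sym (subst (λ y → SameEdge (Spoke.edge s₂) (φ k , y)) (sym same-end) (Spoke.edge-ends s₂)))

branch-degree : ∀ {G s d} → Undirected G → (I : KImmersion G (suc s)) (k : Fin (suc s)) →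
                DegreeAtMost G (KImmersion.φ I k) d → s ≤ d
branch-degree {G} {s} {d} undirected I k deg = ≮⇒≥ no-collision
  where
  open KImmersion I
  open DegreeAtMost deg
  open Spoke

  spokeTo : (j : Fin s) → Spoke I k (punchIn k j)
  spokeTo j = spoke I undirected k (punchIn k j) (punchInᵢ≢i k j)

  no-collision : ¬ (d < s)
  no-collision d<s with pigeonhole d<s (λ j → code (adjacent (spokeTo j)))
  ... | j₁ , j₂ , j₁<j₂ , same-code =
    disj (from s₁) (to s₁) (from s₂) (to s₂) (ordered s₁) (ordered s₂)
         (spokes-on-distinct-paths I (λ eq → <⇒≢ j₁<j₂ (punchIn-injective k j₁ j₂ eq))
            (punchInᵢ≢i k j₁) (punchInᵢ≢i k j₂) (joins s₁) (joins s₂))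
         (edge s₁) (edge s₂) (edge∈path s₁) (edge∈path s₂)
         (spokes-with-same-end I s₁ s₂ (code-injective (adjacent s₁) (adjacent s₂) same-code))
    where
    s₁ : Spoke I k (punchIn k j₁)
    s₁ = spokeTo j₁
    s₂ : Spoke I k (punchIn k j₂)
    s₂ = spokeTo j₂

immersion-size-bound : ∀ {G d t} → Undirected G → (apex : V G) →
                       (∀ x → x ≡ apex ⊎ DegreeAtMost G x d) → KImmersion G t → t ≤ suc d
immersion-size-bound {t = zero}        _ _ _ _ = z≤n
immersion-size-bound {t = suc zero}    _ _ _ _ = s≤s z≤n
immersion-size-bound {t = suc (suc s)} undirected apex degree I
  with degree (KImmersion.φ I 0F) | degree (KImmersion.φ I 1F)
... | inj₂ deg₀    | _            = s≤s (branch-degree undirected I 0F deg₀)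
... | inj₁ _       | inj₂ deg₁    = s≤s (branch-degree undirected I 1F deg₁)
... | inj₁ φ₀≡apex | inj₁ φ₁≡apex with () ← KImmersion.φ-inj I (trans φ₀≡apex (sym φ₁≡apex))

Cycle-undirected : ∀ {n} → Undirected (Cycle n)
Cycle-undirected (inj₁ r) = inj₂ r
Cycle-undirected (inj₂ r) = inj₁ r

module _ {n : ℕ} {u v v′ : Fin n} where

  successor-unique : CycleAdj n u v → CycleAdj n u v′ → v ≡ v′
  successor-unique (inj₁ p)       (inj₁ q)       = toℕ-injective (trans (sym p) q)
  successor-unique (inj₁ p)       (inj₂ (q , _)) = contradiction (trans (sym p) q) (λ v≡n → <-irrefl v≡n (toℕ<n v))
  successor-unique (inj₂ (p , _)) (inj₁ q)       = contradiction (trans (sym q) p) (λ v′≡n → <-irrefl v′≡n (toℕ<n v′))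
  successor-unique (inj₂ (_ , p)) (inj₂ (_ , q)) = toℕ-injective (trans p (sym q))

  predecessor-unique : CycleAdj n v u → CycleAdj n v′ u → v ≡ v′
  predecessor-unique (inj₁ p)       (inj₁ q)       = toℕ-injective (suc-injective (trans p (sym q)))
  predecessor-unique (inj₁ p)       (inj₂ (_ , q)) with () ← trans p q
  predecessor-unique (inj₂ (_ , p)) (inj₁ q)       with () ← trans q p
  predecessor-unique (inj₂ (p , _)) (inj₂ (q , _)) = toℕ-injective (suc-injective (trans p (sym q)))

Cycle-degree : ∀ {n} (u : Fin n) → DegreeAtMost (Cycle n) u 2
Cycle-degree u = record { code = direction ; code-injective = injective }
  where
  direction : ∀ {v} → Adj (Cycle _) u v → Fin 2
  direction (inj₁ _) = 0F
  direction (inj₂ _) = 1F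
  injective : ∀ {v v′} (p : Adj (Cycle _) u v) (q : Adj (Cycle _) u v′) → direction p ≡ direction q → v ≡ v′
  injective (inj₁ p) (inj₁ q) _ = successor-unique p q
  injective (inj₂ p) (inj₂ q) _ = predecessor-unique p q

Consecutive : ∀ {k} → Fin k → Fin k → Set
Consecutive i j = suc (toℕ i) ≡ toℕ j ⊎ suc (toℕ j) ≡ toℕ i

LayerAdj : ∀ {m} → Fin m → Fin m → Set
LayerAdj i j = (toℕ i ≡ 0 × toℕ j ≡ 0) ⊎ Consecutive i j

module _ {m : ℕ} where

  LayerAdj-sym : ∀ {i j : Fin m} → LayerAdj i j → LayerAdj j i
  LayerAdj-sym (inj₁ (p , q))   = inj₁ (q , p)
  LayerAdj-sym (inj₂ (inj₁ p)) = inj₂ (inj₂ p)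
  LayerAdj-sym (inj₂ (inj₂ p)) = inj₂ (inj₁ p)

  ascends : ∀ {i j : Fin m} → LayerAdj i j → Fin 2
  ascends (inj₂ (inj₁ _)) = 1F
  ascends _               = 0F

  layer-determined : ∀ {i j j′ : Fin m} (l : LayerAdj i j) (l′ : LayerAdj i j′) → ascends l ≡ ascends l′ → j ≡ j′
  layer-determined (inj₁ (_ , p))   (inj₁ (_ , q))   _ = toℕ-injective (trans p (sym q))
  layer-determined (inj₁ (p , _))   (inj₂ (inj₂ q)) _ with () ← trans q p
  layer-determined (inj₂ (inj₂ p)) (inj₁ (q , _))   _ with () ← trans p q
  layer-determined (inj₂ (inj₂ p)) (inj₂ (inj₂ q)) _ = toℕ-injective (suc-injective (trans p (sym q)))
  layer-determined (inj₂ (inj₁ p)) (inj₂ (inj₁ q)) _ = toℕ-injective (trans (sym p) q)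

  nothing-above-top : ∀ {i j : Fin m} (l : LayerAdj i j) → suc (toℕ i) ≡ m → ascends l ≢ 1F
  nothing-above-top {j = j} (inj₂ (inj₁ p)) top _ = <-irrefl (trans (sym p) top) (toℕ<n j)

Mycielskian-undirected : ∀ {G m} → Undirected G → Undirected (Mycielskian m G)
Mycielskian-undirected undirected {just _}  {just _}  (r , l) = undirected r , LayerAdj-sym l
Mycielskian-undirected _          {just _}  {nothing} top     = top
Mycielskian-undirected _          {nothing} {just _}  top     = top

-- A neighbour of (u, i) is determined by the edge of G below it and by whether it lies in layer
-- i + 1; the apex only neighbours the top layer, which has nothing above it, and takes an upward code.
Mycielskian-degree : ∀ {G m d} → (∀ u → DegreeAtMost G u (suc d)) →
                     ∀ u i → DegreeAtMost (Mycielskian m G) (just (u , i)) (2 * suc d)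
Mycielskian-degree {G} {m} {d} degree u i = record { code = code ; code-injective = injective }
  where
  open DegreeAtMost (degree u) renaming (code to codeG; code-injective to codeG-injective)

  code : ∀ {y} → Adj (Mycielskian m G) (just (u , i)) y → Fin (2 * suc d)
  code {just _}  (r , l) = Fin.combine (ascends l) (codeG r)
  code {nothing} _       = Fin.combine {m = 2} {n = suc d} (1F) 0F

  injective : ∀ {y z} (p : Adj (Mycielskian m G) (just (u , i)) y) (q : Adj (Mycielskian m G) (just (u , i)) z) →
              code p ≡ code q → y ≡ z
  injective {just _}  {just _}  (r , l) (r′ , l′) eq with combine-injective (ascends l) (codeG r) (ascends l′) (codeG r′) eq
  ... | same-direction , same-code =
    cong₂ (λ v j → just (v , j)) (codeG-injective r r′ same-code) (layer-determined l l′ same-direction)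
  injective {just _}  {nothing} (r , l) top eq =
    contradiction (proj₁ (combine-injective (ascends l) (codeG r) _ _ eq)) (nothing-above-top l top)
  injective {nothing} {just _}  top (r , l) eq =
    contradiction (sym (proj₁ (combine-injective _ _ (ascends l) (codeG r) eq))) (nothing-above-top l top)
  injective {nothing} {nothing} _ _ _ = refl

Mycielskian₁-degree : ∀ {G d} → (∀ u → DegreeAtMost G u d) →
                      ∀ u i → DegreeAtMost (Mycielskian 1 G) (just (u , i)) (suc d)
Mycielskian₁-degree {G} {d} degree u i = record { code = code ; code-injective = injective }
  where
  open DegreeAtMost (degree u) renaming (code to codeG; code-injective to codeG-injective)

  code : ∀ {y} → Adj (Mycielskian 1 G) (just (u , i)) y → Fin (suc d)
  code {just _}  (r , _) = Fin.suc (codeG r)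
  code {nothing} _       = 0F

  injective : ∀ {y z} (p : Adj (Mycielskian 1 G) (just (u , i)) y) (q : Adj (Mycielskian 1 G) (just (u , i)) z) →
              code p ≡ code q → y ≡ z
  injective {just (_ , 0F)} {just (_ , 0F)} (r , _) (r′ , _) eq =
    cong (λ v → just (v , 0F)) (codeG-injective r r′ (Fin-suc-injective eq))
  injective {nothing} {nothing} _ _ _ = refl

Mycielskian-immersion-bound : ∀ {G m d t} → Undirected G →
                              (∀ u i → DegreeAtMost (Mycielskian m G) (just (u , i)) d) →
                              KImmersion (Mycielskian m G) t → t ≤ suc d
Mycielskian-immersion-bound undirected degree =
  immersion-size-bound (Mycielskian-undirected undirected) nothing apex-or-degree
  where
  apex-or-degree : ∀ x → x ≡ nothing ⊎ DegreeAtMost _ x _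
  apex-or-degree (just (u , i)) = inj₂ (degree u i)
  apex-or-degree nothing        = inj₁ refl

-- Transporting immersions along embeddings

record Embedding (H G : Graph) : Set where
  field
    to        : V H → V G
    injective : ∀ {a b} → to a ≡ to b → a ≡ b
    adjacent  : ∀ {a b} → Adj H a b → Adj G (to a) (to b)

module _ {H G : Graph} (f : Embedding H G) where
  open Embedding f

  toEdge : V H × V H → V G × V G
  toEdge = Product.map to to

  mapWalk : ∀ {a b} → Walk H a b → Walk G (to a) (to b)
  mapWalk []         = []
  mapWalk (step r w) = step (adjacent r) (mapWalk w)

  vertices-mapWalk : ∀ {a b} (w : Walk H a b) → vertices (mapWalk w) ≡ List.map to (vertices w)
  vertices-mapWalk []         = refl
  vertices-mapWalk (step _ w) = cong (_ ∷_) (vertices-mapWalk w)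

  edges-mapWalk : ∀ {a b} (w : Walk H a b) → edges (mapWalk w) ≡ List.map toEdge (edges w)
  edges-mapWalk []         = refl
  edges-mapWalk (step _ w) = cong (_ ∷_) (edges-mapWalk w)

  SameEdge-reflect : ∀ e e′ → SameEdge (toEdge e) (toEdge e′) → SameEdge e e′
  SameEdge-reflect _ _ (inj₁ (p , q)) = inj₁ (injective p , injective q)
  SameEdge-reflect _ _ (inj₂ (p , q)) = inj₂ (injective p , injective q)

  EdgeDisjoint-mapWalk : ∀ {a b c d} (w₁ : Walk H a b) (w₂ : Walk H c d) →
                         EdgeDisjoint w₁ w₂ → EdgeDisjoint (mapWalk w₁) (mapWalk w₂)
  EdgeDisjoint-mapWalk w₁ w₂ disjoint e₁ e₂ e₁∈ e₂∈ same
    with ∈-map⁻ toEdge (subst (e₁ ∈_) (edges-mapWalk w₁) e₁∈)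
       | ∈-map⁻ toEdge (subst (e₂ ∈_) (edges-mapWalk w₂) e₂∈)
  ... | h₁ , h₁∈ , refl | h₂ , h₂∈ , refl = disjoint h₁ h₂ h₁∈ h₂∈ (SameEdge-reflect h₁ h₂ same)

  immersion-transport : ∀ {t} → KImmersion H t → KImmersion G t
  immersion-transport I = record
    { φ      = to ∘ φ
    ; φ-inj  = φ-inj ∘ injective
    ; path   = λ i j p → mapWalk (path i j p)
    ; isPath = λ i j p → subst Unique (sym (vertices-mapWalk (path i j p))) (Unique.map⁺ injective (isPath i j p))
    ; disj   = λ i j k l p q ne → EdgeDisjoint-mapWalk (path i j p) (path k l q) (disj i j k l p q ne)
    }
    where open KImmersion I

Path : ℕ → Graph
Path k = record { V = Fin k ; Adj = Consecutive }

ConeAdj : (G : Graph) (m : ℕ) → Maybe (V G × Fin m) → Maybe (V G × Fin m) → Set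
ConeAdj G m (just (u , i)) (just (v , j)) = Adj G u v × Consecutive i j
ConeAdj G m (just (u , i)) nothing        = suc (toℕ i) ≡ m
ConeAdj G m nothing        (just (v , j)) = suc (toℕ j) ≡ m
ConeAdj G m nothing        nothing        = ⊥

-- The m-Mycielskian without the copy of G on layer 0, so that its layers can be shifted upwards.
Cone : ℕ → Graph → Graph
Cone m G = record { V = Maybe (V G × Fin m) ; Adj = ConeAdj G m }

just-pair-injective : ∀ {A B : Set} {a a′ : A} {b b′ : B} → just (a , b) ≡ just (a′ , b′) → a ≡ a′ × b ≡ b′
just-pair-injective = Product.,-injective ∘ Maybe.just-injective

Path↪Cycle : ∀ {k n} → k ≤ n → Embedding (Path k) (Cycle n)
Path↪Cycle {k} {n} k≤n = record { to = to ; injective = injective ; adjacent = adjacent }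
  where
  to : Fin k → Fin n
  to i = inject≤ i k≤n
  injective : ∀ {i j} → to i ≡ to j → i ≡ j
  injective {i} {j} eq = toℕ-injective (trans (sym (toℕ-inject≤ i k≤n)) (trans (cong toℕ eq) (toℕ-inject≤ j k≤n)))
  adjacent : ∀ {i j} → Consecutive i j → Adj (Cycle n) (to i) (to j)
  adjacent {i} {j} (inj₁ p) = inj₁ (inj₁ (subst₂ (λ a b → suc a ≡ b) (sym (toℕ-inject≤ i k≤n)) (sym (toℕ-inject≤ j k≤n)) p))
  adjacent {i} {j} (inj₂ p) = inj₂ (inj₁ (subst₂ (λ a b → suc a ≡ b) (sym (toℕ-inject≤ j k≤n)) (sym (toℕ-inject≤ i k≤n)) p))

module _ {H G : Graph} (f : Embedding H G) where
  module F = Embedding f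

  Mycielskian-map : ∀ {m} → Embedding (Mycielskian m H) (Mycielskian m G)
  Mycielskian-map {m} = record { to = to ; injective = injective ; adjacent = adjacent }
    where
    to : V (Mycielskian m H) → V (Mycielskian m G)
    to (just (u , i)) = just (F.to u , i)
    to nothing        = nothing
    injective : ∀ {a b} → to a ≡ to b → a ≡ b
    injective {just _}  {just _}  eq with just-pair-injective eq
    ... | p , refl = cong (λ u → just (u , _)) (F.injective p)
    injective {nothing} {nothing} _ = refl
    adjacent : ∀ {a b} → Adj (Mycielskian m H) a b → Adj (Mycielskian m G) (to a) (to b)
    adjacent {just _}  {just _}  (r , l) = F.adjacent r , l
    adjacent {just _}  {nothing} top     = top
    adjacent {nothing} {just _}  top     = top

  Cone-shift : ∀ {m} j → Embedding (Cone m H) (Mycielskian (j + m) G)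
  Cone-shift {m} j = record { to = to ; injective = injective ; adjacent = adjacent }
    where
    to : V (Cone m H) → V (Mycielskian (j + m) G)
    to (just (u , i)) = just (F.to u , j ↑ʳ i)
    to nothing        = nothing
    injective : ∀ {a b} → to a ≡ to b → a ≡ b
    injective {just _}  {just _}  eq with just-pair-injective eq
    ... | p , q = cong₂ (λ u i → just (u , i)) (F.injective p) (↑ʳ-injective j _ _ q)
    injective {nothing} {nothing} _ = refl
    shift : ∀ {x} (i : Fin m) → suc (toℕ i) ≡ x → suc (toℕ (j ↑ʳ i)) ≡ j + x
    shift i p = trans (cong suc (toℕ-↑ʳ j i)) (trans (sym (+-suc j (toℕ i))) (cong (j +_) p))
    adjacent : ∀ {a b} → Adj (Cone m H) a b → Adj (Mycielskian (j + m) G) (to a) (to b)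
    adjacent {just (_ , i)} {just (_ , i′)} (r , inj₁ p) = F.adjacent r , inj₂ (inj₁ (trans (shift i p) (sym (toℕ-↑ʳ j i′))))
    adjacent {just (_ , i)} {just (_ , i′)} (r , inj₂ p) = F.adjacent r , inj₂ (inj₂ (trans (shift i′ p) (sym (toℕ-↑ʳ j i))))
    adjacent {just (_ , i)} {nothing}       top          = shift i top
    adjacent {nothing}      {just (_ , i)}  top          = shift i top

-- Immersions checked by evaluation

steps : ∀ {A : Set} → List A → List (A × A)
steps (x ∷ y ∷ ys) = (x , y) ∷ steps (y ∷ ys)
steps _            = []

module _ {G : Graph} where

  walkAlong : ∀ a xs b → Linked (Adj G) (a ∷ xs ++ [ b ]) → Walk G a b
  walkAlong a []       b (r ∷ [-]) = step r []
  walkAlong a (x ∷ xs) b (r ∷ l)   = step r (walkAlong x xs b l)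

  vertices-walkAlong : ∀ a xs b l → vertices (walkAlong a xs b l) ≡ a ∷ xs ++ [ b ]
  vertices-walkAlong a []       b (r ∷ [-]) = refl
  vertices-walkAlong a (x ∷ xs) b (r ∷ l)   = cong (a ∷_) (vertices-walkAlong x xs b l)

  edges-walkAlong : ∀ a xs b l → edges (walkAlong a xs b l) ≡ steps (a ∷ xs ++ [ b ])
  edges-walkAlong a []       b (r ∷ [-]) = refl
  edges-walkAlong a (x ∷ xs) b (r ∷ l)   = cong ((a , x) ∷_) (edges-walkAlong x xs b l)

module Certificate {G : Graph} (_≟_ : DecidableEquality (V G)) (adj? : Decidable (Adj G))
                   {t : ℕ} (φ : Fin t → V G) (via : Fin t → Fin t → List (V G)) where

  route : Fin t → Fin t → List (V G)
  route i j = φ i ∷ via i j ++ [ φ j ]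

  Valid : Set
  Valid = (∀ i j → φ i ≡ φ j → i ≡ j)
        × (∀ i j → i Fin.< j → Linked (Adj G) (route i j) × Unique (route i j))
        × (∀ i j k l → i Fin.< j → k Fin.< l → ¬ (i ≡ k × j ≡ l) →
             All (λ e → All (λ e′ → ¬ SameEdge e e′) (steps (route k l))) (steps (route i j)))

  sameEdge? : Decidable (SameEdge {V G})
  sameEdge? (x , y) (x′ , y′) = ((x ≟ x′) ×-dec (y ≟ y′)) ⊎-dec ((x ≟ y′) ×-dec (y ≟ x′))

  valid? : Dec Valid
  valid? = (all? λ i → all? λ j → (φ i ≟ φ j) →-dec (i ≟ᶠ j))
     ×-dec (all? λ i → all? λ j → (i <? j) →-dec (linked? adj? (route i j) ×-dec unique? _≟_ (route i j)))
     ×-dec (all? λ i → all? λ j → all? λ k → all? λ l →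
              (i <? j) →-dec (k <? l) →-dec ¬? ((i ≟ᶠ k) ×-dec (j ≟ᶠ l)) →-dec
              All.all? (λ e → All.all? (λ e′ → ¬? (sameEdge? e e′)) (steps (route k l))) (steps (route i j)))

  immersion : Valid → KImmersion G t
  immersion (injective , routes , disjoint) = record
    { φ      = φ
    ; φ-inj  = λ {i} {j} → injective i j
    ; path   = path
    ; isPath = λ i j p → subst Unique (sym (vertices-walkAlong _ _ _ (linked p))) (proj₂ (routes i j p))
    ; disj   = λ i j k l p q ne e₁ e₂ e₁∈ e₂∈ →
        All.lookup (All.lookup (disjoint i j k l p q ne) (subst (e₁ ∈_) (edges-walkAlong _ _ _ (linked p)) e₁∈))
                   (subst (e₂ ∈_) (edges-walkAlong _ _ _ (linked q)) e₂∈)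
    }
    where
    linked : ∀ {i j} (p : i Fin.< j) → Linked (Adj G) (route i j)
    linked {i} {j} p = proj₁ (routes i j p)
    path : ∀ i j → i Fin.< j → Walk G (φ i) (φ j)
    path i j p = walkAlong (φ i) (via i j) (φ j) (linked p)

consecutive? : ∀ {k} → Decidable (Consecutive {k})
consecutive? i j = (suc (toℕ i) ℕ.≟ toℕ j) ⊎-dec (suc (toℕ j) ℕ.≟ toℕ i)

Cycle-adj? : ∀ {n} → Decidable (Adj (Cycle n))
Cycle-adj? {n} i j = cycleAdj? i j ⊎-dec cycleAdj? j i
  where
  cycleAdj? : Decidable (CycleAdj n)
  cycleAdj? i j = (suc (toℕ i) ℕ.≟ toℕ j) ⊎-dec ((suc (toℕ i) ℕ.≟ n) ×-dec (toℕ j ℕ.≟ 0))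

layered-≟ : ∀ {A : Set} {m} → DecidableEquality A → DecidableEquality (Maybe (A × Fin m))
layered-≟ _≟_ = Maybe.≡-dec (Product.≡-dec _≟_ _≟ᶠ_)

layerAdj? : ∀ {m} → Decidable (LayerAdj {m})
layerAdj? i j = ((toℕ i ℕ.≟ 0) ×-dec (toℕ j ℕ.≟ 0)) ⊎-dec consecutive? i j

Mycielskian-adj? : ∀ {G m} → Decidable (Adj G) → Decidable (Adj (Mycielskian m G))
Mycielskian-adj? adj? (just (u , i)) (just (v , j)) = adj? u v ×-dec layerAdj? i j
Mycielskian-adj? {m = m} _ (just (u , i)) nothing        = suc (toℕ i) ℕ.≟ m
Mycielskian-adj? {m = m} _ nothing        (just (v , j)) = suc (toℕ j) ℕ.≟ m
Mycielskian-adj?         _ nothing        nothing        = no λ ()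

Cone-adj? : ∀ {G m} → Decidable (Adj G) → Decidable (Adj (Cone m G))
Cone-adj? adj? (just (u , i)) (just (v , j)) = adj? u v ×-dec consecutive? i j
Cone-adj? {m = m} _ (just (u , i)) nothing        = suc (toℕ i) ℕ.≟ m
Cone-adj? {m = m} _ nothing        (just (v , j)) = suc (toℕ j) ℕ.≟ m
Cone-adj?         _ nothing        nothing        = no λ ()

module Certificates where

  -- Between consecutive columns of the long arc k − 1, …, 5 of C_k there are exactly three edges of
  -- the Mycielskian; the paths 0–3, 0–4 and 1–4 take one each, the first two alternating between the
  -- layers according to column parity. This works for every k ≥ 5 but is only checked up to k = 11.
  module OnCycle (r j : ℕ) where
    k : ℕ
    k = 5 + r

    G : Graph
    G = Mycielskian (2 + j) (Cycle k)

    even : ℕ → Bool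
    even zero    = true
    even (suc n) = not (even n)

    lane : (ℕ → Bool) → List (V G)
    lane raised = List.map (λ c → just (c , (if raised (toℕ c) then 1F else 0F)))
                           (List.reverse (List.drop 5 (List.allFin k)))

    φ : Fin 5 → V G
    φ i = just (i ↑ˡ r , 0F)

    via : Fin 5 → Fin 5 → List (V G)
    via 0F 2F = [ just (# 1 , 1F) ]
    via 1F 3F = [ just (# 2 , 1F) ]
    via 2F 4F = [ just (# 3 , 1F) ]
    via 0F 3F = lane even ++ [ just (# 4 , 1F) ]
    via 0F 4F = lane (not ∘ even)
    via 1F 4F = just (# 0 , 1F) ∷ lane (λ _ → false)
    via _  _  = []

    open Certificate (layered-≟ _≟ᶠ_) (Mycielskian-adj? Cycle-adj?) φ via public

  -- On a long cycle the apex replaces the long way round, so a path of the cycle suffices.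
  module OnPath₉ where
    G : Graph
    G = Mycielskian 2 (Path 9)

    φ : Fin 5 → V G
    φ i = just (2 ↑ʳ (i ↑ˡ 2) , 0F)

    via : Fin 5 → Fin 5 → List (V G)
    via 0F 2F = [ just (# 3 , 1F) ]
    via 1F 3F = [ just (# 4 , 1F) ]
    via 2F 4F = [ just (# 5 , 1F) ]
    via 0F 3F = just (# 1 , 0F) ∷ just (# 0 , 1F) ∷ nothing ∷ just (# 6 , 1F) ∷ []
    via 0F 4F = just (# 1 , 1F) ∷ nothing ∷ just (# 7 , 1F) ∷ []
    via 1F 4F = just (# 2 , 1F) ∷ nothing ∷ just (# 8 , 1F) ∷ just (# 7 , 0F) ∷ []
    via _  _  = []

    open Certificate (layered-≟ _≟ᶠ_) (Mycielskian-adj? consecutive?) φ via public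

  -- For m ≥ 3 the apex is only adjacent to the top layer, so the paths stay in the top three layers.
  module OnCone₁₂ where
    G : Graph
    G = Cone 3 (Path 12)

    φ : Fin 5 → V G
    φ 0F = nothing
    φ 1F = just (# 3 , 1F)
    φ 2F = just (# 4 , 1F)
    φ 3F = just (# 7 , 1F)
    φ 4F = just (# 8 , 1F)

    via : Fin 5 → Fin 5 → List (V G)
    via 0F 1F = [ just (# 4 , 2F) ]
    via 0F 2F = [ just (# 3 , 2F) ]
    via 0F 3F = [ just (# 6 , 2F) ]
    via 0F 4F = [ just (# 7 , 2F) ]
    via 1F 2F = just (# 2 , 0F) ∷ just (# 1 , 1F) ∷ just (# 0 , 2F) ∷ nothing ∷ just (# 5 , 2F) ∷ []
    via 1F 3F = just (# 4 , 0F) ∷ just (# 5 , 1F) ∷ just (# 6 , 0F) ∷ []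
    via 1F 4F = just (# 2 , 2F) ∷ nothing ∷ just (# 11 , 2F) ∷ just (# 10 , 1F) ∷ just (# 9 , 0F) ∷ []
    via 2F 3F = just (# 3 , 0F) ∷ just (# 2 , 1F) ∷ just (# 1 , 2F) ∷ nothing ∷ just (# 8 , 2F) ∷ []
    via 2F 4F = just (# 5 , 0F) ∷ just (# 6 , 1F) ∷ just (# 7 , 0F) ∷ []
    via 3F 4F = just (# 8 , 0F) ∷ just (# 9 , 1F) ∷ just (# 10 , 2F) ∷ nothing ∷ just (# 9 , 2F) ∷ []
    via _  _  = []

    open Certificate (layered-≟ _≟ᶠ_) (Cone-adj? consecutive?) φ via public

  module OnPath₅ where
    G : Graph
    G = Mycielskian 1 (Path 5)

    φ : Fin 4 → V G
    φ 0F = nothing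
    φ i  = just (Fin.inject₁ i , 0F)

    via : Fin 4 → Fin 4 → List (V G)
    via 1F 3F = just (# 0 , 0F) ∷ nothing ∷ just (# 4 , 0F) ∷ []
    via _  _  = []

    open Certificate (layered-≟ _≟ᶠ_) (Mycielskian-adj? consecutive?) φ via public

K₅-in-Mycielskian-Cycle : ∀ r j → KImmersion (Mycielskian (2 + j) (Cycle (5 + r))) 5
K₅-in-Mycielskian-Cycle 0 j = immersion (from-yes valid?) where open Certificates.OnCycle 0 j
K₅-in-Mycielskian-Cycle 1 j = immersion (from-yes valid?) where open Certificates.OnCycle 1 j
K₅-in-Mycielskian-Cycle 2 j = immersion (from-yes valid?) where open Certificates.OnCycle 2 j
K₅-in-Mycielskian-Cycle 3 j = immersion (from-yes valid?) where open Certificates.OnCycle 3 j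
K₅-in-Mycielskian-Cycle 4 j = immersion (from-yes valid?) where open Certificates.OnCycle 4 j
K₅-in-Mycielskian-Cycle 5 j = immersion (from-yes valid?) where open Certificates.OnCycle 5 j
K₅-in-Mycielskian-Cycle 6 j = immersion (from-yes valid?) where open Certificates.OnCycle 6 j
K₅-in-Mycielskian-Cycle (suc (suc (suc (suc (suc (suc (suc r))))))) zero =
  immersion-transport (Mycielskian-map (Path↪Cycle (m≤m+n 9 (3 + r)))) (immersion (from-yes valid?))
  where open Certificates.OnPath₉
K₅-in-Mycielskian-Cycle (suc (suc (suc (suc (suc (suc (suc r))))))) (suc j) =
  subst (λ m → KImmersion (Mycielskian m (Cycle (12 + r))) 5) (+-comm j 3)
    (immersion-transport (Cone-shift (Path↪Cycle (m≤m+n 12 r)) j) (immersion (from-yes valid?)))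
  where open Certificates.OnCone₁₂

K₄-in-Mycielskian₁-Cycle : ∀ {n} → 5 ≤ n → KImmersion (Mycielskian 1 (Cycle n)) 4
K₄-in-Mycielskian₁-Cycle 5≤n = immersion-transport (Mycielskian-map (Path↪Cycle 5≤n)) (immersion (from-yes valid?))
  where open Certificates.OnPath₅

proposition4 : (n : ℕ) → 5 ≤ n →
    ImmersionNumber (Mycielskian 1 (Cycle n)) 4 ×
    ((m : ℕ) → 2 ≤ m → ImmersionNumber (Mycielskian m (Cycle n)) 5)
proposition4 n 5≤n with m≤n⇒∃[o]m+o≡n 5≤n
... | r , refl =
    (K₄-in-Mycielskian₁-Cycle 5≤n , λ _ → Mycielskian-immersion-bound Cycle-undirected (Mycielskian₁-degree Cycle-degree))
  , λ { (suc (suc j)) _ → K₅-in-Mycielskian-Cycle r j , λ _ → Mycielskian-immersion-bound Cycle-undirected (Mycielskian-degree Cycle-degree)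
      ; (suc zero) (s≤s ()) }
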